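{- Let $\mathcal{P}$ be a program, let $\mathcal{C}$ be a program component of $\mathcal{P}$ with entry transitions $\mathcal{E}_{\mathcal{C}}$, and let $(t_{\mathrm{exit}}, \varphi)$ be an assertion such that $t_{\mathrm{exit}} = (\tilde\ell_{\mathrm{exit}}, \tau_{\mathrm{exit}}, \ell_{\mathrm{exit}})$ is an exit transition of $\mathcal{C}$ and $\varphi$ is a clause (a disjunction of linear inequalities over the program variables). If the procedure call $\mathsf{CondSafe}(\mathcal{C}, \mathcal{E}_{\mathcal{C}}, (t_{\mathrm{exit}}, \varphi))$ returns $\mathcal{Q} \neq \mathsf{None}$, then $\mathcal{Q}$ is a conditional inductive invariant for $\mathcal{C}$, and for every entry transition $t = (\ell, \tau, \ell') \in \mathcal{E}_{\mathcal{C}}$ the program $\mathcal{P}$ is $(t, \mathcal{Q}(\ell'))$-conditionally safe for the assertion $(t_{\mathrm{exit}}, \varphi)$.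
   Context: Programs. Fix integer program variables $\mathcal{V} = \{v_1,\dots,v_n\}$ and primed copies $\mathcal{V}' = \{v_1',\dots,v_n'\}$ (values after a step); for a formula $\psi$ over $\mathcal{V}$, $\psi'$ denotes the same formula over $\mathcal{V}'$. Let $\mathcal{L}$ be a finite set of locations containing a start location $\ell_0$. A transition is a triple $(\ell, \tau, \ell')$ with $\ell,\ell' \in \mathcal{L}$ and $\tau$ a conjunction of linear inequalities over $\mathcal{V} \cup \mathcal{V}'$; a program $\mathcal{P}$ is a finite set of transitions, viewed as a directed multigraph (control-flow graph) on $\mathcal{L}$. A state is $(\ell, \vec v)$ with $\ell \in \mathcal{L}$ and $\vec v : \mathcal{V} \to \mathbb{Z}$; an evaluation step $(\ell,\vec v) \to_t (\ell',\vec v')$ with $t = (\ell,\tau,\ell')$ means that $(\vec v, \vec v')$ satisfies $\tau$; $\to_{\mathcal{P}}$ is a step with any transition of $\mathcal{P}$ and $\to^*_{\mathcal{P}}$ its reflexive-transitive closure. An assertion is a pair $(t,\varphi)$ of a transition and a formula over $\mathcal{V}$. Conditional safety. For transitions $t,\tilde t$ and formulas $\varphi, \tilde\varphi$ over $\mathcal{V}$, $\mathcal{P}$ is $(\tilde t, \tilde\varphi)$-conditionally safe for $(t,\varphi)$ if for every evaluation containing $\to_{\tilde t} (\tilde\ell, \tilde{\vec v}) \to^*_{\mathcal{P}} (\bar\ell, \bar{\vec v}) \to_t (\ell, \vec v)$, $\tilde{\vec v} \models \tilde\varphi$ implies $\vec v \models \varphi$. Components. A program component $\mathcal{C}$ is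 (the set of transitions of) a strongly connected component of the control-flow graph; its entry transitions $\mathcal{E}_{\mathcal{C}}$ are the transitions $(\ell,\tau,\ell') \notin \mathcal{C}$ with $\ell'$ a location of $\mathcal{C}$. A transition $t \notin \mathcal{C}$ whose source location is a location of $\mathcal{C}$ is an exit transition of $\mathcal{C}$. Conditional inductive invariant. A map $\mathcal{Q}$ from locations to conjunctions of linear inequalities over $\mathcal{V}$ is a conditional inductive invariant for $\mathcal{C}$ if for every step $(\ell,\vec v) \to_t (\ell',\vec v')$ with $t \in \mathcal{C}$, $\vec v \models \mathcal{Q}(\ell)$ implies $\vec v' \models \mathcal{Q}(\ell')$. Procedure $\mathsf{CondSafe}(\mathcal{C}, \mathcal{E}_{\mathcal{C}}, (t_{\mathrm{exit}},\varphi))$. For $k = 1, 2, \dots, \mathsf{MAX\_CONJUNCTS}$ (a fixed bound) it does the following. For each location $\ell$ of $\mathcal{C}$ it creates a template $I_{\ell,k} \equiv \bigwedge_{j=1}^k I_{\ell,j,k}$ with $I_{\ell,j,k} \equiv i_{\ell,j} + \sum_{v \in \mathcal{V}} i_{\ell,j,v}\cdot v \le 0$, where the coefficients $i_{\ell,j}, i_{\ell,j,v}$ are fresh unknowns (template variables); $I'_{\ell,k}$ is the same template over the primed variables. It then builds a weighted Max-SMT problem over the template variables whose hard constraints are: (Consecution) for each $t = (\ell,\tau,\ell') \in \mathcal{C}$, $I_{\ell,k} \wedge \tau \Rightarrow I'_{\ell',k}$ holds for all values of $\mathcal{V}\cup\mathcal{V}'$; (Safety) $I_{\tilde\ell_{\mathrm{exit}},k}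 \wedge \tau_{\mathrm{exit}} \Rightarrow \varphi'$ holds for all values of $\mathcal{V}\cup\mathcal{V}'$; and whose soft constraints are (Initiation) for each $t = (\ell,\tau,\ell') \in \mathcal{E}_{\mathcal{C}}$ and $1\le j\le k$, $\tau \Rightarrow I'_{\ell',j,k}$. If a solver returns an assignment $\sigma$ of the template variables satisfying all hard constraints, the procedure returns $\mathcal{Q} = \{\ell \mapsto \sigma(I_{\ell,k}) \mid \ell \text{ a location of } \mathcal{C}\}$; otherwise it proceeds with $k+1$. If no $k \le \mathsf{MAX\_CONJUNCTS}$ succeeds, it returns $\mathsf{None}$. -}

module Defs where

open import Data.Nat using (ℕ; zero; suc)
open import Data.Fin using (Fin; zero; suc)
open import Data.Fin.Subset using (Subset; _∈_; _∉_)
open import Data.Integer using (ℤ; _+_; _*_; _≤_; 0ℤ)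
open import Data.List using (List)
open import Data.List.Relation.Unary.All using (All)
open import Data.List.Relation.Unary.Any using (Any)
import Data.List.Membership.Propositional as LM
open import Data.Vec using (Vec; toList)
open import Data.Product using (Σ; _×_; _,_; ∃)
open import Relation.Nullary using (¬_)
open import Relation.Binary.PropositionalEquality using (_≡_)
open import Relation.Binary.Construct.Closure.ReflexiveTransitive using (Star)

sumFin : (n : ℕ) → (Fin n → ℤ) → ℤ
sumFin zero    f = 0ℤ
sumFin (suc n) f = f zero + sumFin n (λ i → f (suc i))

Valuation : ℕ → Set
Valuation n = Fin n → ℤ

record LinIneq (n : ℕ) : Set where
  constructor linIneq
  field
    const : ℤ
    coef  : Fin n → ℤ

SatIneq : ∀ {n} → LinIneq n → Valuation n → Set
SatIneq {n} (linIneq c a) v = c + sumFin n (λ i → a i * v i) ≤ 0ℤ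

Conj : ℕ → Set
Conj n = List (LinIneq n)

SatConj : ∀ {n} → Conj n → Valuation n → Set
SatConj ψ v = All (λ c → SatIneq c v) ψ

Clause : ℕ → Set
Clause n = List (LinIneq n)

SatClause : ∀ {n} → Clause n → Valuation n → Set
SatClause φ v = Any (λ c → SatIneq c v) φ

record LinIneq₂ (n : ℕ) : Set where
  constructor linIneq₂
  field
    const  : ℤ
    coef   : Fin n → ℤ
    coef'  : Fin n → ℤ

SatIneq₂ : ∀ {n} → LinIneq₂ n → Valuation n → Valuation n → Set
SatIneq₂ {n} (linIneq₂ c a b) v v' =
  (c + sumFin n (λ i → a i * v i)) + sumFin n (λ i → b i * v' i) ≤ 0ℤ

TransFormula : ℕ → Set
TransFormula n = List (LinIneq₂ n)

SatTrans : ∀ {n} → TransFormula n → Valuation n → Valuation n → Set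
SatTrans τ v v' = All (λ c → SatIneq₂ c v v') τ

record Transition (n L : ℕ) : Set where
  constructor trans
  field
    src : Fin L
    τ   : TransFormula n
    tgt : Fin L

open Transition public

record Program (n L : ℕ) : Set where
  constructor program
  field
    start       : Fin L
    transitions : List (Transition n L)

open Program public

_∈P_ : ∀ {n L} → Transition n L → Program n L → Set
t ∈P P = LM._∈_ t (transitions P)

State : ℕ → ℕ → Set
State n L = Fin L × Valuation n

Step : ∀ {n L} → Transition n L → State n L → State n L → Set
Step t (ℓ , v) (ℓ' , v') = (src t ≡ ℓ) × (tgt t ≡ ℓ') × SatTrans (τ t) v v'

StepP : ∀ {n L} → Program n L → State n L → State n L → Set
StepP P s s' = Σ (Transition _ _) λ t → t ∈P P × Step t s s'

Steps : ∀ {n L} → Program n L → State n L → State n L → Set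
Steps P = Star (StepP P)

CondSafe : ∀ {n L} → Program n L →
           Transition n L → (Valuation n → Set) →
           Transition n L → (Valuation n → Set) → Set
CondSafe {n} {L} P t̃ φ̃ t φ =
  ∀ (s₀ : State n L) (ℓ̃ : Fin L) (ṽ : Valuation n)
    (ℓ̄ : Fin L) (v̄ : Valuation n) (ℓ : Fin L) (v : Valuation n) →
  Step t̃ s₀ (ℓ̃ , ṽ) → Steps P (ℓ̃ , ṽ) (ℓ̄ , v̄) → Step t (ℓ̄ , v̄) (ℓ , v) →
  φ̃ ṽ → φ v

CFGEdge : ∀ {n L} → Program n L → Fin L → Fin L → Set
CFGEdge P a b = Σ (Transition _ _) λ t → t ∈P P × src t ≡ a × tgt t ≡ b

CFGPath : ∀ {n L} → Program n L → Fin L → Fin L → Set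
CFGPath P = Star (CFGEdge P)

IsSCC : ∀ {n L} → Program n L → Subset L → Set
IsSCC {n} {L} P S =
  (∃ λ ℓ → ℓ ∈ S) ×
  (∀ a b → a ∈ S → b ∈ S → CFGPath P a b) ×
  (∀ a b → a ∈ S → CFGPath P a b → CFGPath P b a → b ∈ S)

-- The program component C determined by the SCC S: the transitions of P
-- between locations of S.
InComp : ∀ {n L} → Program n L → Subset L → Transition n L → Set
InComp P S t = t ∈P P × src t ∈ S × tgt t ∈ S

IsEntry : ∀ {n L} → Program n L → Subset L → Transition n L → Set
IsEntry P S t = t ∈P P × ¬ InComp P S t × tgt t ∈ S

IsExit : ∀ {n L} → Program n L → Subset L → Transition n L → Set
IsExit P S t = t ∈P P × ¬ InComp P S t × src t ∈ S

IsCondInductiveInv : ∀ {n L} → Program n L → Subset L → (Fin L → Conj n) → Set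
IsCondInductiveInv {n} {L} P S Q =
  ∀ (t : Transition n L) → InComp P S t →
  ∀ (v v' : Valuation n) → Step t (src t , v) (tgt t , v') →
  SatConj (Q (src t)) v → SatConj (Q (tgt t)) v'

-- The procedure CondSafe(C, E_C, (t_exit, φ))
-- A template assignment σ for k conjuncts gives, for each location, k
-- linear inequalities (the instantiated I_{ℓ,j,k}).

TemplateAssignment : ℕ → ℕ → ℕ → Set
TemplateAssignment n L k = Fin L → Vec (LinIneq n) k

inst : ∀ {n L k} → TemplateAssignment n L k → Fin L → Conj n
inst σ ℓ = toList (σ ℓ)

Consecution : ∀ {n L k} → Program n L → Subset L → TemplateAssignment n L k → Set
Consecution {n} {L} P S σ =
  ∀ (t : Transition n L) → InComp P S t →
  ∀ (v v' : Valuation n) →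
  SatConj (inst σ (src t)) v → SatTrans (τ t) v v' → SatConj (inst σ (tgt t)) v'

SafetyC : ∀ {n L k} → Transition n L → Clause n → TemplateAssignment n L k → Set
SafetyC {n} texit φ σ =
  ∀ (v v' : Valuation n) →
  SatConj (inst σ (src texit)) v → SatTrans (τ texit) v v' → SatClause φ v'

-- soft constraint (Initiation) for entry transition t and conjunct j
-- (does not influence whether the procedure returns; recorded for completeness)
Initiation : ∀ {n L k} → Transition n L → TemplateAssignment n L k → Fin k → Set
Initiation {n} t σ j =
  ∀ (v v' : Valuation n) → SatTrans (τ t) v v' →
  SatIneq (Data.Vec.lookup (σ (tgt t)) j) v'

-- "CondSafe(C, E_C, (t_exit, φ)) returns Q" (with MAX_CONJUNCTS = MAX):
-- in some round 1 ≤ k ≤ MAX the solver returned an assignment σ satisfying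
-- all hard constraints, and Q maps each location ℓ of C to σ(I_{ℓ,k}).
CondSafeReturns : ∀ {n L} (MAX : ℕ) → Program n L → Subset L →
                  Transition n L → Clause n → (Fin L → Conj n) → Set
CondSafeReturns {n} {L} MAX P S texit φ Q =
  Σ ℕ λ k → (1 Data.Nat.≤ k) × (k Data.Nat.≤ MAX) ×
  Σ (TemplateAssignment n L k) λ σ →
    Consecution P S σ × SafetyC texit φ σ ×
    (∀ ℓ → ℓ ∈ S → Q ℓ ≡ inst σ ℓ)

module Submission where

-- Suppose the procedure returns Q, i.e. some assignment σ of the template
-- variables satisfies the hard constraints and Q agrees with σ(I_ℓ) on the
-- locations of C.  Consecution of σ says exactly that Q is a conditional
-- inductive invariant of C (first half of the theorem).  For the second
-- half, take an evaluation that enters C by an entry transition t, runs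
-- for a while in P, and leaves by t_exit.  The key graph-theoretic fact is
-- that such a run never leaves C: every location it visits is reachable
-- from a location of C and reaches a location of C, so by maximality of
-- the SCC it belongs to C; hence every step is a transition of C.  An
-- inductive invariant is therefore preserved along the run, so Q holds
-- just before t_exit, and the Safety constraint yields φ afterwards.

open import Defs
open import Data.Nat using (ℕ)
open import Data.Fin using (Fin)
open import Data.Fin.Subset using (Subset; _∈_)
open import Data.Product using (_×_; _,_)
open import Relation.Binary.PropositionalEquality using (_≡_; refl)
open import Relation.Binary.Construct.Closure.ReflexiveTransitive using (ε; _◅_; _◅◅_)

module _ {n L : ℕ} (P : Program n L) where

  stepsToPath : ∀ {a c v w} → Steps P (a , v) (c , w) → CFGPath P a c
  stepsToPath ε = ε
  stepsToPath (_◅_ {j = _ , _} (t , t∈P , src≡ , tgt≡ , _) rest) =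
    (t , t∈P , src≡ , tgt≡) ◅ stepsToPath rest

  module _ {S : Subset L} (scc : IsSCC P S) where

    -- Convexity of an SCC: a location reachable from S that can reach S
    -- again lies in S (close the cycle through S, then use maximality).
    betweenSCC : ∀ {a b c} → a ∈ S → CFGPath P a b → CFGPath P b c → c ∈ S → b ∈ S
    betweenSCC {a} {b} {c} a∈S a⇝b b⇝c c∈S =
      let (_ , connected , maximal) = scc
      in maximal a b a∈S a⇝b (b⇝c ◅◅ connected c a c∈S a∈S)

    -- An evaluation of P between two locations of the component uses only
    -- transitions of the component, so it preserves any conditional
    -- inductive invariant of the component.
    invariantAlongSteps : ∀ {Q : Fin L → Conj n} → IsCondInductiveInv P S Q →
      ∀ {a c v w} → a ∈ S → c ∈ S → Steps P (a , v) (c , w) →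
      SatConj (Q a) v → SatConj (Q c) w
    invariantAlongSteps inv a∈S c∈S ε Qa = Qa
    invariantAlongSteps {Q} inv {a} {v = v} a∈S c∈S
                        (_◅_ {j = b , u} (t , t∈P , refl , refl , sat) rest) Qa =
      invariantAlongSteps inv b∈S c∈S rest Qb
      where
        b∈S : b ∈ S
        b∈S = betweenSCC a∈S ((t , t∈P , refl , refl) ◅ ε) (stepsToPath rest) c∈S

        Qb : SatConj (Q b) u
        Qb = inv t (t∈P , a∈S , b∈S) v u (refl , refl , sat) Qa

  consecutionInvariant : ∀ {S : Subset L} {k} {σ : TemplateAssignment n L k}
    {Q : Fin L → Conj n} → Consecution P S σ →
    (∀ ℓ → ℓ ∈ S → Q ℓ ≡ inst σ ℓ) → IsCondInductiveInv P S Q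
  consecutionInvariant cons Q≡σ t (t∈P , src∈S , tgt∈S) v v' (_ , _ , sat) Qsrc
    rewrite Q≡σ (src t) src∈S | Q≡σ (tgt t) tgt∈S =
    cons t (t∈P , src∈S , tgt∈S) v v' Qsrc sat

theorem1 : ∀ {n L : ℕ} (MAX : ℕ) (P : Program n L) (S : Subset L) →
    IsSCC P S →
    (texit : Transition n L) → IsExit P S texit →
    (φ : Clause n) → (Q : Fin L → Conj n) →
    CondSafeReturns MAX P S texit φ Q →
    IsCondInductiveInv P S Q ×
    (∀ (t : Transition n L) → IsEntry P S t →
    CondSafe P t (SatConj (Q (tgt t))) texit (SatClause φ))
theorem1 MAX P S scc texit (_ , _ , src∈S) φ Q (k , _ , _ , σ , cons , safety , Q≡σ) =
  invariantQ , condSafe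
  where
    invariantQ : IsCondInductiveInv P S Q
    invariantQ = consecutionInvariant P cons Q≡σ

    -- Q holds on entry, is carried through the component to the source of
    -- t_exit, and there the Safety constraint gives φ after t_exit.
    condSafe : ∀ t → IsEntry P S t → CondSafe P t (SatConj (Q (tgt t))) texit (SatClause φ)
    condSafe t (_ , _ , tgt∈S) _ _ ṽ _ v̄ _ v (_ , refl , _) run (refl , _ , exitStep) Qṽ
      with invariantAlongSteps P scc invariantQ tgt∈S src∈S run Qṽ
    ... | Qv̄ rewrite Q≡σ (src texit) src∈S = safety v̄ v Qv̄ exitStep
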